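{- Let $A, B, X$ be finite sets with contention and let $f : A \to \mathcal{P}_c X$ and $g : B \to \mathcal{P}_c X$ be morphisms of sets with contention. Suppose $(U', V')$ and $(U'', V'')$ are two distinct minimal $(f,g)$-synchronisations, both contained (pointwise) in an $(f,g)$-synchronisation $(U, V)$. Then $U' \cap U'' = \varnothing$ and $V' \cap V'' = \varnothing$.
   Context: A set with contention ($c$-set) is a pair $(X, \frown_X)$ with $\frown_X \subseteq X \times X$ reflexive and symmetric. A morphism of $c$-sets $h : X \to Y$ is a function such that $h(x) \frown_Y h(x')$ implies $x \frown_X x'$. A subset $U \subseteq X$ is independent if $u \frown_X u'$ implies $u = u'$ for all $u,u' \in U$; $\mathcal{P}_c X$ is the set of independent subsets of $X$, a $c$-set with $U \frown V$ iff some $u \in U$, $v \in V$ satisfy $u \frown_X v$. For $h : X \to \mathcal{P}_c Y$ and $U \in \mathcal{P}_c X$, $h^\#(U) = \bigcup_{u \in U} h(u)$. An $(f,g)$-synchronisation is a pair $(U, V)$ with $U \in \mathcal{P}_c A$, $V \in \mathcal{P}_c B$ and $f^\#(U) = g^\#(V)$. Synchronisations are ordered pointwise: $(U,V) \subseteq (U',V')$ iff $U \subseteq U'$ and $V \subseteq V'$. The trivial synchronisation is $(\varnothing, \varnothing)$. A synchronisation $(U,V)$ is minimal if it is not trivial and every synchronisation $(U',V') \subseteq (U,V)$ is either trivial or equal to $(U,V)$. -}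

module Defs where

open import Data.Nat using (ℕ; zero; suc)
open import Data.Fin using (Fin; zero; suc)
open import Data.Fin.Subset using (Subset; _∈_; _⊆_; _∪_; ⊥; inside; outside)
open import Data.Vec using (_∷_; [])
open import Data.Product using (Σ; ∃; _×_)
open import Data.Sum using (_⊎_)
open import Relation.Binary.PropositionalEquality using (_≡_)
open import Relation.Nullary using (¬_)
open import Level using (0ℓ) renaming (suc to lsuc)

record CSet (n : ℕ) : Set₁ where
  field
    _⌢_   : Fin n → Fin n → Set
    ⌢-refl : ∀ x → x ⌢ x
    ⌢-sym  : ∀ {x y} → x ⌢ y → y ⌢ x

open CSet public

Independent : ∀ {n} → CSet n → Subset n → Set
Independent X U = ∀ u u' → u ∈ U → u' ∈ U → _⌢_ X u u' → u ≡ u'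

_⌢P[_]_ : ∀ {n} → Subset n → CSet n → Subset n → Set
U ⌢P[ X ] V = ∃ λ u → ∃ λ v → u ∈ U × v ∈ V × _⌢_ X u v

-- a morphism of c-sets h : A → P_c X (given as a function into subsets,
-- with every value independent)
record CMorP {m n : ℕ} (A : CSet m) (X : CSet n) : Set where
  field
    fun   : Fin m → Subset n
    indep : ∀ a → Independent X (fun a)
    mor   : ∀ a a' → fun a ⌢P[ X ] fun a' → _⌢_ A a a'

open CMorP public

sharp : ∀ {m n} → (Fin m → Subset n) → Subset m → Subset n
sharp h [] = ⊥
sharp h (inside ∷ U) = h zero ∪ sharp (λ i → h (suc i)) U
sharp h (outside ∷ U) = sharp (λ i → h (suc i)) U

module _ {a b x : ℕ} {A : CSet a} {B : CSet b} {X : CSet x}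
         (f : CMorP A X) (g : CMorP B X) where

  IsSync : Subset a → Subset b → Set
  IsSync U V = Independent A U × Independent B V × sharp (fun f) U ≡ sharp (fun g) V

  Trivial : Subset a → Subset b → Set
  Trivial U V = U ≡ ⊥ × V ≡ ⊥

  IsMinimalSync : Subset a → Subset b → Set
  IsMinimalSync U V =
    IsSync U V × ¬ Trivial U V ×
    (∀ U₀ V₀ → IsSync U₀ V₀ → U₀ ⊆ U → V₀ ⊆ V →
       Trivial U₀ V₀ ⊎ (U₀ ≡ U × V₀ ≡ V))

module Submission where

-- The key fact is that the pointwise intersection of two synchronisations
-- (U',V') and (U'',V'') contained in a synchronisation (U,V) is again a
-- synchronisation.  Independence of the intersections is inherited from U'
-- and V'.  For f#(U'∩U'') ⊆ g#(V'∩V''): a point y ∈ f(u) with u ∈ U'∩U''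
-- lies in g(v') for some v' ∈ V' and in g(v'') for some v'' ∈ V''; since
-- g is a morphism, g(v') and g(v'') meeting forces v' ⌢ v'', and
-- independence of V forces v' = v''.  The reverse inclusion is the same
-- argument with f and g exchanged.
--
-- The theorem then follows from minimality: the intersection lies inside
-- (U',V'), so it is trivial or equal to (U',V'); in the latter case
-- (U',V') is a nontrivial synchronisation inside the minimal (U'',V''),
-- hence equal to it, contradicting distinctness.

open import Defs
open import Data.Nat using (ℕ)
open import Data.Fin using (Fin; zero; suc)
open import Data.Fin.Subset using (Subset; _⊆_; _∩_; ⊥; _∈_; inside; outside)
open import Data.Fin.Subset.Properties
  using (∉⊥; x∈p∪q⁻; x∈p∪q⁺; x∈p∩q⁺; x∈p∩q⁻; p∩q⊆p; p∩q⊆q; ⊆-antisym)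
open import Data.Vec using (_∷_; []; here; there)
open import Data.Product using (_×_; _,_; ∃; proj₁)
open import Data.Sum using (inj₁; inj₂)
open import Data.Empty using (⊥-elim)
open import Relation.Binary.PropositionalEquality using (_≡_; refl; sym; subst)
open import Relation.Nullary using (¬_)

∈-sharp⁻ : ∀ {m n} (h : Fin m → Subset n) (U : Subset m) {y : Fin n} →
           y ∈ sharp h U → ∃ λ u → u ∈ U × y ∈ h u
∈-sharp⁻ h []           y∈ = ⊥-elim (∉⊥ y∈)
∈-sharp⁻ h (inside ∷ U) y∈ with x∈p∪q⁻ (h zero) (sharp (λ i → h (suc i)) U) y∈
... | inj₁ y∈h0 = zero , here , y∈h0
... | inj₂ y∈rest with ∈-sharp⁻ (λ i → h (suc i)) U y∈rest
...   | u , u∈U , y∈hu = suc u , there u∈U , y∈hu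
∈-sharp⁻ h (outside ∷ U) y∈ with ∈-sharp⁻ (λ i → h (suc i)) U y∈
... | u , u∈U , y∈hu = suc u , there u∈U , y∈hu

∈-sharp⁺ : ∀ {m n} (h : Fin m → Subset n) (U : Subset m) {y : Fin n} (u : Fin m) →
           u ∈ U → y ∈ h u → y ∈ sharp h U
∈-sharp⁺ h (inside ∷ U)  zero    here        y∈hu = x∈p∪q⁺ (inj₁ y∈hu)
∈-sharp⁺ h (inside ∷ U)  (suc u) (there u∈U) y∈hu =
  x∈p∪q⁺ {p = h zero} (inj₂ (∈-sharp⁺ (λ i → h (suc i)) U u u∈U y∈hu))
∈-sharp⁺ h (outside ∷ U) (suc u) (there u∈U) y∈hu =
  ∈-sharp⁺ (λ i → h (suc i)) U u u∈U y∈hu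

independent-⊆ : ∀ {n} (X : CSet n) {U W : Subset n} →
                Independent X U → W ⊆ U → Independent X W
independent-⊆ X indU W⊆U w w' w∈W w'∈W = indU w w' (W⊆U w∈W) (W⊆U w'∈W)

∩-absorbs⇒⊆ : ∀ {n} (p q : Subset n) → p ∩ q ≡ p → p ⊆ q
∩-absorbs⇒⊆ p q p∩q≡p x∈p = p∩q⊆q p q (subst (_ ∈_) (sym p∩q≡p) x∈p)

shared-image⇒≡ : ∀ {b x} {B : CSet b} {X : CSet x} (g : CMorP B X) {V : Subset b} →
                 Independent B V → ∀ {y} v v' → v ∈ V → v' ∈ V →
                 y ∈ fun g v → y ∈ fun g v' → v ≡ v'
shared-image⇒≡ {X = X} g indV {y} v v' v∈V v'∈V y∈gv y∈gv' =
  indV v v' v∈V v'∈V (mor g v v' (y , y , y∈gv , y∈gv' , ⌢-refl X y))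

covered-by-sharp : ∀ {a b x} (h : Fin a → Subset x) (k : Fin b → Subset x)
                   {U : Subset a} {V : Subset b} → sharp h U ≡ sharp k V →
                   ∀ {y} u → u ∈ U → y ∈ h u → ∃ λ v → v ∈ V × y ∈ k v
covered-by-sharp h k {U} {V} eq {y} u u∈U y∈hu =
  ∈-sharp⁻ k V (subst (y ∈_) eq (∈-sharp⁺ h U u u∈U y∈hu))

sharp-∩-⊆ : ∀ {a b x} {B : CSet b} {X : CSet x}
            (h : Fin a → Subset x) (g : CMorP B X)
            {U' U'' : Subset a} {V V' V'' : Subset b} →
            Independent B V → V' ⊆ V → V'' ⊆ V →
            sharp h U' ≡ sharp (fun g) V' → sharp h U'' ≡ sharp (fun g) V'' →
            sharp h (U' ∩ U'') ⊆ sharp (fun g) (V' ∩ V'')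
sharp-∩-⊆ h g {U'} {U''} {V} {V'} {V''} indV V'⊆V V''⊆V eq' eq'' {y} y∈
  with ∈-sharp⁻ h (U' ∩ U'') y∈
... | u , u∈U'∩U'' , y∈hu
  with x∈p∩q⁻ U' U'' u∈U'∩U''
... | u∈U' , u∈U''
  with covered-by-sharp h (fun g) eq' u u∈U' y∈hu
     | covered-by-sharp h (fun g) eq'' u u∈U'' y∈hu
... | v , v∈V' , y∈gv | v'' , v''∈V'' , y∈gv''
  -- g(v) and g(v'') share y, so v = v'' lies in V' ∩ V''
  with shared-image⇒≡ g indV v v'' (V'⊆V v∈V') (V''⊆V v''∈V'') y∈gv y∈gv''
... | refl = ∈-sharp⁺ (fun g) (V' ∩ V'') v (x∈p∩q⁺ (v∈V' , v''∈V'')) y∈gv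

module _ {a b x : ℕ} {A : CSet a} {B : CSet b} {X : CSet x}
         (f : CMorP A X) (g : CMorP B X) where

  sync-∩ : {U U' U'' : Subset a} {V V' V'' : Subset b} →
           IsSync f g U V → IsSync f g U' V' → IsSync f g U'' V'' →
           U' ⊆ U → V' ⊆ V → U'' ⊆ U → V'' ⊆ V →
           IsSync f g (U' ∩ U'') (V' ∩ V'')
  sync-∩ {U} {U'} {U''} {V} {V'} {V''}
         (indU , indV , _) (indU' , indV' , eq') (_ , _ , eq'') U'⊆U V'⊆V U''⊆U V''⊆V =
      independent-⊆ A indU' (p∩q⊆p U' U'')
    , independent-⊆ B indV' (p∩q⊆p V' V'')
    , ⊆-antisym
        (sharp-∩-⊆ (fun f) g {U'} {U''} {V} {V'} {V''} indV V'⊆V V''⊆V eq' eq'')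
        (sharp-∩-⊆ (fun g) f {V'} {V''} {U} {U'} {U''} indU U'⊆U U''⊆U (sym eq') (sym eq''))

  nontrivial⊆minimal⇒≡ : {U' U'' : Subset a} {V' V'' : Subset b} →
                         IsSync f g U' V' → ¬ Trivial f g U' V' →
                         IsMinimalSync f g U'' V'' →
                         U' ⊆ U'' → V' ⊆ V'' → U' ≡ U'' × V' ≡ V''
  nontrivial⊆minimal⇒≡ sync' nontrivial' (_ , _ , minimal'') U'⊆U'' V'⊆V''
    with minimal'' _ _ sync' U'⊆U'' V'⊆V''
  ... | inj₁ trivial' = ⊥-elim (nontrivial' trivial')
  ... | inj₂ equal    = equal

lemma2 : {a b x : ℕ} {A : CSet a} {B : CSet b} {X : CSet x}
    (f : CMorP A X) (g : CMorP B X)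
    (U U' U'' : Subset a) (V V' V'' : Subset b) →
    IsSync f g U V →
    IsMinimalSync f g U' V' →
    IsMinimalSync f g U'' V'' →
    ¬ (U' ≡ U'' × V' ≡ V'') →
    U' ⊆ U → V' ⊆ V → U'' ⊆ U → V'' ⊆ V →
    (U' ∩ U'' ≡ ⊥) × (V' ∩ V'' ≡ ⊥)
lemma2 f g U U' U'' V V' V'' sync (sync' , nontrivial' , minimality')
       minimal'' distinct U'⊆U V'⊆V U''⊆U V''⊆V
  with minimality' (U' ∩ U'') (V' ∩ V'')
         (sync-∩ f g sync sync' (proj₁ minimal'') U'⊆U V'⊆V U''⊆U V''⊆V)
         (p∩q⊆p U' U'') (p∩q⊆p V' V'')
... | inj₁ trivial = trivial
... | inj₂ (U'∩U''≡U' , V'∩V''≡V') =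
  ⊥-elim (distinct (nontrivial⊆minimal⇒≡ f g sync' nontrivial' minimal''
    (∩-absorbs⇒⊆ U' U'' U'∩U''≡U') (∩-absorbs⇒⊆ V' V'' V'∩V''≡V')))
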